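{- Let $\lambda$ be a partition of $n$ with $\lambda_1\ge2$, and let $\ell=\ell(\lambda)$ be its number of parts. Let $A$ be a uniformly random standard Young tableau of shape $\lambda$, and define $$q_i=\mathbf{P}\bigl[A(i,1)<A(1,2)<A(i+1,1)\bigr]\ (1\le i\le\ell-1),\qquad q_\ell=\mathbf{P}\bigl[A(\ell,1)<A(1,2)\bigr].$$ Then $q_1\ge q_2\ge\cdots\ge q_\ell$ and $q_1+\cdots+q_\ell=1$.
   Context: A standard Young tableau of shape $\lambda\vdash n$ is a bijection $A$ from the cells $\{(i,j):1\le j\le\lambda_i\}$ of the Young diagram to $\{1,\ldots,n\}$ that is increasing along rows (in $j$) and down columns (in $i$). -}

module Defs where

open import Data.Bool using (Bool; true; false; _∧_; not)
open import Data.Nat using (ℕ; zero; suc; _≤_; _≥_; _<ᵇ_; _≤ᵇ_; _≡ᵇ_)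
open import Data.Integer using (+_)
open import Data.List using (List; []; _∷_; length; concat; concatMap; map; filterᵇ; applyUpTo; foldr)
open import Data.Nat.ListAction using (sum)
open import Data.Bool.ListAction using (all; any)
open import Data.List.Relation.Unary.All using (All)
open import Data.List.Relation.Unary.Linked using (Linked)
open import Data.Maybe using (Maybe; just; nothing)
open import Data.Product using (_×_)
open import Data.Rational using (ℚ; 0ℚ; _/_; _+_)

IsPartition : List ℕ → Set
IsPartition λ′ = All (1 ≤_) λ′ × Linked _≥_ λ′

-- A filling of the Young diagram of shape (r₁,…,rₗ) is a list of rows,
-- row i being the list (A(i,1), …, A(i,rᵢ)).

words : ℕ → ℕ → List (List ℕ)
words n zero    = [] ∷ []
words n (suc r) = concatMap (λ x → map (x ∷_) (words n r)) (applyUpTo suc n)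

fillings : ℕ → List ℕ → List (List (List ℕ))
fillings n []       = [] ∷ []
fillings n (r ∷ rs) = concatMap (λ row → map (row ∷_) (fillings n rs)) (words n r)

increasingᵇ : List ℕ → Bool
increasingᵇ (x ∷ y ∷ xs) = (x <ᵇ y) ∧ increasingᵇ (y ∷ xs)
increasingᵇ _            = true

belowᵇ : List ℕ → List ℕ → Bool
belowᵇ (x ∷ xs) (y ∷ ys) = (x <ᵇ y) ∧ belowᵇ xs ys
belowᵇ _        []       = true
belowᵇ []       (_ ∷ _)  = false

columnsᵇ : List (List ℕ) → Bool
columnsᵇ (r ∷ r′ ∷ rs) = belowᵇ r r′ ∧ columnsᵇ (r′ ∷ rs)
columnsᵇ _             = true

distinctᵇ : List ℕ → Bool
distinctᵇ []       = true
distinctᵇ (x ∷ xs) = not (any (x ≡ᵇ_) xs) ∧ distinctᵇ xs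

inRangeᵇ : ℕ → List ℕ → Bool
inRangeᵇ n = all (λ x → (1 ≤ᵇ x) ∧ (x ≤ᵇ n))

-- A filling with n cells is a standard Young tableau iff its entries are
-- distinct elements of {1,…,n} (i.e. a bijection onto {1,…,n}),
-- increasing along rows and down columns.
isSYTᵇ : ℕ → List (List ℕ) → Bool
isSYTᵇ n T = all increasingᵇ T ∧ columnsᵇ T ∧ distinctᵇ (concat T) ∧ inRangeᵇ n (concat T)

SYTs : List ℕ → List (List (List ℕ))
SYTs sh = filterᵇ (isSYTᵇ (sum sh)) (fillings (sum sh) sh)

nth : {A : Set} → List A → ℕ → Maybe A
nth []       _       = nothing
nth (x ∷ xs) zero    = just x
nth (x ∷ xs) (suc k) = nth xs k

-- A(i,j), 1-indexed (value 0 outside the diagram; never used there)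
entry : List (List ℕ) → ℕ → ℕ → ℕ
entry T (suc i) (suc j) with nth T i
... | just row with nth row j
...   | just v  = v
...   | nothing = 0
entry T (suc i) (suc j) | nothing = 0
entry T _ _ = 0

eventᵇ : ℕ → ℕ → List (List ℕ) → Bool
eventᵇ ℓ i T with suc i ≤ᵇ ℓ
... | true  = (entry T i 1 <ᵇ entry T 1 2) ∧ (entry T 1 2 <ᵇ entry T (suc i) 1)
... | false = entry T i 1 <ᵇ entry T 1 2

prob : ℕ → ℕ → ℚ
prob c zero    = 0ℚ
prob c (suc t) = (+ c) / suc t

q : List ℕ → ℕ → ℚ
q sh i = prob (length (filterᵇ (eventᵇ (length sh) i) (SYTs sh))) (length (SYTs sh))

qSum : List ℕ → ℚ
qSum sh = foldr _+_ 0ℚ (map (q sh) (applyUpTo suc (length sh)))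

-- In a standard tableau the first column A(1,1) < ⋯ < A(ℓ,1) cuts the values above
-- A(1,1) into the intervals (A(i,1), A(i+1,1)) and (A(ℓ,1), ∞). The entry A(1,2)
-- exceeds A(1,1) and is not in the first column, so it lies in exactly one of them:
-- the ℓ events are a partition and q₁ + ⋯ + qₗ = 1.
-- If A(i+1,1) < A(1,2) < A(i+2,1) (the upper bound void when i+1 = ℓ), exchanging the
-- entries A(1,2) and A(i+1,1) gives again a standard tableau, now with
-- A(i,1) < A(1,2) < A(i+1,1). Exchanging back recovers the original tableau, so the
-- event of q_{i+1} injects into that of qᵢ.
module Submission where

open import Defs
open import Data.Bool using (Bool; true; false; T; T?; not; _∧_; if_then_else_)
open import Data.Bool.ListAction using (any)
open import Data.Bool.Properties using (T-∧; T-not-≡)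
open import Data.Integer as ℤ using ()
import Data.Integer.Properties as ℤ
open import Data.Integer.Tactic.RingSolver using (solve-∀)
open import Data.List
  using (List; []; _∷_; _++_; length; map; foldr; concat; concatMap; filterᵇ; applyUpTo; cartesianProductWith)
open import Data.List.Membership.Propositional using (_∈_)
open import Data.List.Membership.Propositional.Properties
  using (∈-∃++; ∈-++⁻; ∈-++⁺ˡ; ∈-++⁺ʳ; ∈-map⁺; ∈-filter⁺; ∈-filter⁻; ∈-length;
         ∈-applyUpTo⁺; ∈-applyUpTo⁻; ∈-cartesianProductWith⁺; ∈-cartesianProductWith⁻)
open import Data.List.Properties using (length-++-sucʳ; length-map; map-cong; ∷-injective; filter-accept; filter-reject)
open import Data.List.Relation.Binary.Permutation.Propositional
  using (_↭_; ↭-refl; ↭-swap; prep; ↭⇒↭ₛ; module PermutationReasoning)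
open import Data.List.Relation.Binary.Permutation.Propositional.Properties
  using (++⁺ˡ; All-resp-↭) renaming (shift to ↭-shift)
open import Data.List.Relation.Binary.Subset.Propositional using (_⊆_)
open import Data.List.Relation.Unary.All as All using (All; []; _∷_)
open import Data.List.Relation.Unary.All.Properties using (all⁺; all⁻; ¬Any⇒All¬; All¬⇒¬Any; concat⁻; map⁻)
import Data.List.Relation.Unary.AllPairs as AllPairs
open import Data.List.Relation.Unary.Any using (here; there)
open import Data.List.Relation.Unary.Any.Properties using (any⁺; any⁻)
open import Data.List.Relation.Unary.Linked as Linked using (Linked; []; [-]; _∷_)
open import Data.List.Relation.Unary.Linked.Properties using (Linked⇒AllPairs)
open import Data.List.Relation.Unary.Unique.Propositional using (Unique; []; _∷_)
import Data.List.Relation.Unary.Unique.Propositional.Properties as Unique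
open import Data.Nat as ℕ using (ℕ; zero; suc; _+_; _*_; _≤_; _<_; z≤n; s≤s; _≡ᵇ_; _≤ᵇ_)
open import Data.Nat.ListAction using (sum)
import Data.Nat.Properties as ℕ
open import Algebra.Properties.CommutativeSemigroup ℕ.+-commutativeSemigroup using (interchange)
open import Data.Product using (_×_; _,_; proj₁; proj₂; ∃₂)
open import Data.Rational using (0ℚ; 1ℚ; toℚᵘ) renaming (_≤_ to _≤ℚ_; _+_ to _+ℚ_)
open import Data.Rational.Properties
  using (toℚᵘ-injective; toℚᵘ-fromℚᵘ; toℚᵘ-homo-+; toℚᵘ-cancel-≤) renaming (≤-refl to ≤ℚ-refl)
open import Data.Rational.Unnormalised using (mkℚᵘ; *≡*; *≤*) renaming (_≃_ to _≃ᵘ_; _+_ to _+ᵘ_)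
import Data.Rational.Unnormalised.Properties as ℚᵘ
open import Data.Sum using (inj₁; inj₂)
open import Function using (_∘_)
open import Function.Bundles using (_⇔_; mk⇔; Equivalence)
open import Relation.Binary.Definitions using (tri<; tri≈; tri>)
open import Relation.Binary.PropositionalEquality
open import Data.List.Relation.Binary.Permutation.Setoid.Properties (setoid ℕ) using (Unique-resp-↭)
open import Relation.Nullary using (¬_; contradiction)

private
  toℚᵘ-prob : ∀ a t → toℚᵘ (prob a (suc t)) ≃ᵘ mkℚᵘ (ℤ.+ a) t
  toℚᵘ-prob a t = toℚᵘ-fromℚᵘ (mkℚᵘ (ℤ.+ a) t)

prob-mono : ∀ {a b} m → a ≤ b → prob a m ≤ℚ prob b m
prob-mono         zero    _   = ≤ℚ-refl
prob-mono {a} {b} (suc t) a≤b = toℚᵘ-cancel-≤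
  (ℚᵘ.≤-respˡ-≃ (ℚᵘ.≃-sym (toℚᵘ-prob a t)) (ℚᵘ.≤-respʳ-≃ (ℚᵘ.≃-sym (toℚᵘ-prob b t))
    (*≤* (ℤ.*-monoʳ-≤-nonNeg (ℤ.+ suc t) (ℤ.+≤+ a≤b)))))

prob-+ : ∀ a b m → prob a m +ℚ prob b m ≡ prob (a + b) m
prob-+ a b zero    = refl
prob-+ a b (suc t) = toℚᵘ-injective (begin-equality
  toℚᵘ (prob a (suc t) +ℚ prob b (suc t))        ≃⟨ toℚᵘ-homo-+ (prob a (suc t)) (prob b (suc t)) ⟩
  toℚᵘ (prob a (suc t)) +ᵘ toℚᵘ (prob b (suc t)) ≃⟨ ℚᵘ.+-cong (toℚᵘ-prob a t) (toℚᵘ-prob b t) ⟩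
  mkℚᵘ (ℤ.+ a) t +ᵘ mkℚᵘ (ℤ.+ b) t               ≃⟨ *≡* same-denominator ⟩
  mkℚᵘ (ℤ.+ (a + b)) t                           ≃⟨ ℚᵘ.≃-sym (toℚᵘ-prob (a + b) t) ⟩
  toℚᵘ (prob (a + b) (suc t))                    ∎)
  where
  open ℚᵘ.≤-Reasoning
  d : ℤ.ℤ
  d = ℤ.+ suc t
  distrib : ∀ x y z → (x ℤ.* z ℤ.+ y ℤ.* z) ℤ.* z ≡ (x ℤ.+ y) ℤ.* (z ℤ.* z)
  distrib = solve-∀
  same-denominator : (ℤ.+ a ℤ.* d ℤ.+ ℤ.+ b ℤ.* d) ℤ.* d ≡ ℤ.+ (a + b) ℤ.* ℤ.+ (suc t * suc t)
  same-denominator = trans (distrib (ℤ.+ a) (ℤ.+ b) d) (cong₂ ℤ._*_ (ℤ.pos-+ a b) (ℤ.pos-* (suc t) (suc t)))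

prob-zero : ∀ m → prob 0 m ≡ 0ℚ
prob-zero zero    = refl
prob-zero (suc t) = toℚᵘ-injective (ℚᵘ.≃-trans (toℚᵘ-prob 0 t) (*≡* refl))

prob-self : ∀ {m} → 0 < m → prob m m ≡ 1ℚ
prob-self {suc t} _ =
  toℚᵘ-injective (ℚᵘ.≃-trans (toℚᵘ-prob (suc t) t) (*≡* (ℤ.*-comm (ℤ.+ suc t) (ℤ.+ 1))))

sum-prob : ∀ {A : Set} (f : A → ℕ) m xs → foldr _+ℚ_ 0ℚ (map (λ x → prob (f x) m) xs) ≡ prob (sum (map f xs)) m
sum-prob f m []       = sym (prob-zero m)
sum-prob f m (x ∷ xs) = trans (cong (prob (f x) m +ℚ_) (sum-prob f m xs)) (prob-+ (f x) (sum (map f xs)) m)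

Unique-⊆⇒length-≤ : ∀ {A : Set} {xs ys : List A} → Unique xs → xs ⊆ ys → length xs ≤ length ys
Unique-⊆⇒length-≤                 []                 _     = z≤n
Unique-⊆⇒length-≤ {xs = x ∷ xs} (x∉xs ∷ xs-unique) xs⊆ys with ∈-∃++ (xs⊆ys (here refl))
... | as , bs , refl =
  ℕ.≤-trans (s≤s (Unique-⊆⇒length-≤ xs-unique xs⊆as++bs)) (ℕ.≤-reflexive (sym (length-++-sucʳ as x bs)))
  where
  xs⊆as++bs : xs ⊆ as ++ bs
  xs⊆as++bs y∈xs with ∈-++⁻ as (xs⊆ys (there y∈xs))
  ... | inj₁ y∈as         = ∈-++⁺ˡ y∈as
  ... | inj₂ (here refl)  = contradiction refl (All.lookup x∉xs y∈xs)
  ... | inj₂ (there y∈bs) = ∈-++⁺ʳ as y∈bs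

private
  indicator : Bool → ℕ
  indicator b = if b then 1 else 0

  length-filterᵇ-∷ : ∀ {A : Set} (p : A → Bool) x xs →
    length (filterᵇ p (x ∷ xs)) ≡ indicator (p x) + length (filterᵇ p xs)
  length-filterᵇ-∷ p x xs with p x
  ... | true  = refl
  ... | false = refl

  length-filterᵇ≡sum : ∀ {A : Set} (p : A → Bool) xs → length (filterᵇ p xs) ≡ sum (map (indicator ∘ p) xs)
  length-filterᵇ≡sum p []       = refl
  length-filterᵇ≡sum p (x ∷ xs) =
    trans (length-filterᵇ-∷ p x xs) (cong (indicator (p x) +_) (length-filterᵇ≡sum p xs))

  sum-map-0 : ∀ {A : Set} (xs : List A) → sum (map (λ _ → 0) xs) ≡ 0
  sum-map-0 []       = refl
  sum-map-0 (_ ∷ xs) = sum-map-0 xs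

  sum-map-+ : ∀ {A : Set} (f g : A → ℕ) xs → sum (map (λ x → f x + g x) xs) ≡ sum (map f xs) + sum (map g xs)
  sum-map-+ f g []       = refl
  sum-map-+ f g (x ∷ xs) = trans (cong (f x + g x +_) (sum-map-+ f g xs))
    (interchange (f x) (g x) (sum (map f xs)) (sum (map g xs)))

sum-length-filterᵇ≡length : ∀ {A B : Set} (E : A → B → Bool) (I : List A) (S : List B) →
  (∀ {t} → t ∈ S → length (filterᵇ (λ i → E i t) I) ≡ 1) →
  sum (map (λ i → length (filterᵇ (E i) S)) I) ≡ length S
sum-length-filterᵇ≡length E I []       _    = sum-map-0 I
sum-length-filterᵇ≡length E I (t ∷ S) once = begin
  sum (map (λ i → length (filterᵇ (E i) (t ∷ S))) I)
    ≡⟨ cong sum (map-cong (λ i → length-filterᵇ-∷ (E i) t S) I) ⟩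
  sum (map (λ i → indicator (E i t) + length (filterᵇ (E i) S)) I)
    ≡⟨ sum-map-+ (λ i → indicator (E i t)) (λ i → length (filterᵇ (E i) S)) I ⟩
  sum (map (λ i → indicator (E i t)) I) + sum (map (λ i → length (filterᵇ (E i) S)) I)
    ≡⟨ cong₂ _+_ (trans (sym (length-filterᵇ≡sum (λ i → E i t) I)) (once (here refl)))
                 (sum-length-filterᵇ≡length E I S (once ∘ there)) ⟩
  suc (length S) ∎
  where open ≡-Reasoning

-- Standard Young tableaux as a predicate

data Above : List ℕ → List ℕ → Set where
  []  : ∀ {xs} → Above xs []
  _∷_ : ∀ {x y xs ys} → x < y → Above xs ys → Above (x ∷ xs) (y ∷ ys)

InRange : ℕ → ℕ → Set
InRange n x = 1 ≤ x × x ≤ n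

record IsTableau (n : ℕ) (t : List (List ℕ)) : Set where
  field
    rows-increasing    : All (Linked _<_) t
    columns-increasing : Linked Above t
    entries-unique     : Unique (concat t)
    entries-in-range   : All (InRange n) (concat t)

private
  ∧-intro : ∀ {a b} → T a → T b → T (a ∧ b)
  ∧-intro p q = Equivalence.from T-∧ (p , q)

T-increasingᵇ : ∀ {xs} → T (increasingᵇ xs) ⇔ Linked _<_ xs
T-increasingᵇ = mk⇔ (to _) from
  where
  to : ∀ xs → T (increasingᵇ xs) → Linked _<_ xs
  to []           _ = []
  to (x ∷ [])     _ = [-]
  to (x ∷ y ∷ xs) h = let x<y , rest = Equivalence.to T-∧ h in ℕ.<ᵇ⇒< x y x<y ∷ to (y ∷ xs) rest
  from : ∀ {xs} → Linked _<_ xs → T (increasingᵇ xs)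
  from []        = _
  from [-]       = _
  from (x<y ∷ l) = ∧-intro (ℕ.<⇒<ᵇ x<y) (from l)

T-belowᵇ : ∀ {xs ys} → T (belowᵇ xs ys) ⇔ Above xs ys
T-belowᵇ = mk⇔ (to _ _) from
  where
  to : ∀ xs ys → T (belowᵇ xs ys) → Above xs ys
  to _        []       _ = []
  to (x ∷ xs) (y ∷ ys) h = let x<y , rest = Equivalence.to T-∧ h in ℕ.<ᵇ⇒< x y x<y ∷ to xs ys rest
  from : ∀ {xs ys} → Above xs ys → T (belowᵇ xs ys)
  from {[]}    []        = _
  from {_ ∷ _} []        = _
  from         (x<y ∷ a) = ∧-intro (ℕ.<⇒<ᵇ x<y) (from a)

T-columnsᵇ : ∀ {t} → T (columnsᵇ t) ⇔ Linked Above t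
T-columnsᵇ = mk⇔ (to _) from
  where
  to : ∀ t → T (columnsᵇ t) → Linked Above t
  to []           _ = []
  to (r ∷ [])     _ = [-]
  to (r ∷ s ∷ rs) h = let r/s , rest = Equivalence.to T-∧ h in Equivalence.to T-belowᵇ r/s ∷ to (s ∷ rs) rest
  from : ∀ {t} → Linked Above t → T (columnsᵇ t)
  from []        = _
  from [-]       = _
  from (r/s ∷ l) = ∧-intro (Equivalence.from T-belowᵇ r/s) (from l)

T-distinctᵇ : ∀ {xs} → T (distinctᵇ xs) ⇔ Unique xs
T-distinctᵇ = mk⇔ (to _) from
  where
  fresh⇒∉ : ∀ x xs → T (not (any (x ≡ᵇ_) xs)) → All (x ≢_) xs
  fresh⇒∉ x xs h = All.map (λ ¬x≡ᵇy x≡y → ¬x≡ᵇy (ℕ.≡⇒≡ᵇ _ _ x≡y))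
    (¬Any⇒All¬ xs (λ x∈ᵇxs → subst T (Equivalence.to T-not-≡ h) (any⁺ (x ≡ᵇ_) x∈ᵇxs)))
  ∉⇒fresh : ∀ {x xs} → All (x ≢_) xs → T (not (any (x ≡ᵇ_) xs))
  ∉⇒fresh {x} {xs} x∉xs with any (x ≡ᵇ_) xs in eq
  ... | false = _
  ... | true  = All¬⇒¬Any (All.map (λ x≢y x≡ᵇy → x≢y (ℕ.≡ᵇ⇒≡ _ _ x≡ᵇy)) x∉xs)
                          (any⁻ (x ≡ᵇ_) xs (subst T (sym eq) _))
  to : ∀ xs → T (distinctᵇ xs) → Unique xs
  to []       _ = []
  to (x ∷ xs) h = let x∉xs , rest = Equivalence.to T-∧ h in fresh⇒∉ x xs x∉xs ∷ to xs rest
  from : ∀ {xs} → Unique xs → T (distinctᵇ xs)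
  from []                 = _
  from (x∉xs ∷ xs-unique) = ∧-intro (∉⇒fresh x∉xs) (from xs-unique)

T-inRangeᵇ : ∀ {n xs} → T (inRangeᵇ n xs) ⇔ All (InRange n) xs
T-inRangeᵇ {n} {xs} = mk⇔
  (λ h → All.map (λ b → let 1≤x , x≤n = Equivalence.to T-∧ b in ℕ.≤ᵇ⇒≤ _ _ 1≤x , ℕ.≤ᵇ⇒≤ _ _ x≤n)
                 (all⁺ _ xs h))
  (λ h → all⁻ _ (All.map (λ (1≤x , x≤n) → ∧-intro (ℕ.≤⇒≤ᵇ 1≤x) (ℕ.≤⇒≤ᵇ x≤n)) h))

T-isSYTᵇ : ∀ {n t} → T (isSYTᵇ n t) ⇔ IsTableau n t
T-isSYTᵇ {n} {t} = mk⇔ to from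
  where
  to : T (isSYTᵇ n t) → IsTableau n t
  to h =
    let rows , h′     = Equivalence.to T-∧ h
        cols , h″     = Equivalence.to T-∧ h′
        uniq , range  = Equivalence.to T-∧ h″
    in
    record
      { rows-increasing    = All.map (Equivalence.to T-increasingᵇ) (all⁺ increasingᵇ t rows)
      ; columns-increasing = Equivalence.to T-columnsᵇ cols
      ; entries-unique     = Equivalence.to T-distinctᵇ uniq
      ; entries-in-range   = Equivalence.to T-inRangeᵇ range
      }
  from : IsTableau n t → T (isSYTᵇ n t)
  from τ = ∧-intro (all⁻ increasingᵇ (All.map (Equivalence.from T-increasingᵇ) rows-increasing))
          (∧-intro (Equivalence.from T-columnsᵇ columns-increasing)
          (∧-intro (Equivalence.from T-distinctᵇ entries-unique) (Equivalence.from T-inRangeᵇ entries-in-range)))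
    where open IsTableau τ

private
  concatMap≡cartesianProduct : ∀ {A : Set} (X : List A) (W : List (List A)) →
    concatMap (λ x → map (x ∷_) W) X ≡ cartesianProductWith _∷_ X W
  concatMap≡cartesianProduct []      W = refl
  concatMap≡cartesianProduct (x ∷ X) W = cong (map (x ∷_) W ++_) (concatMap≡cartesianProduct X W)

module _ {A : Set} (X : List A) (W : List (List A)) where

  ∈-consEach⁺ : ∀ {x w} → x ∈ X → w ∈ W → x ∷ w ∈ concatMap (λ x → map (x ∷_) W) X
  ∈-consEach⁺ x∈X w∈W =
    subst (_ ∈_) (sym (concatMap≡cartesianProduct X W)) (∈-cartesianProductWith⁺ _∷_ x∈X w∈W)

  ∈-consEach⁻ : ∀ {v} → v ∈ concatMap (λ x → map (x ∷_) W) X →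
    ∃₂ λ x w → x ∈ X × w ∈ W × v ≡ x ∷ w
  ∈-consEach⁻ v∈ = ∈-cartesianProductWith⁻ _∷_ X W (subst (_ ∈_) (concatMap≡cartesianProduct X W) v∈)

  consEach⁺ : Unique X → Unique W → Unique (concatMap (λ x → map (x ∷_) W) X)
  consEach⁺ X-unique W-unique = subst Unique (sym (concatMap≡cartesianProduct X W))
    (Unique.cartesianProductWith⁺ _∷_ ∷-injective X-unique W-unique)

∈-range⁺ : ∀ {n x} → InRange n x → x ∈ applyUpTo suc n
∈-range⁺ {x = suc i} (_ , i<n) = ∈-applyUpTo⁺ suc i<n

∈-range⁻ : ∀ {n x} → x ∈ applyUpTo suc n → InRange n x
∈-range⁻ x∈ with _ , i<n , refl ← ∈-applyUpTo⁻ suc x∈ = s≤s z≤n , i<n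

unique-range : ∀ n → Unique (applyUpTo suc n)
unique-range n = Unique.applyUpTo⁺₁ suc n (λ i<j _ → ℕ.<⇒≢ i<j ∘ ℕ.suc-injective)

∈-words⁺ : ∀ {n w} → All (InRange n) w → w ∈ words n (length w)
∈-words⁺ []        = here refl
∈-words⁺ (x∈ ∷ w∈) = ∈-consEach⁺ _ _ (∈-range⁺ x∈) (∈-words⁺ w∈)

∈-words⁻ : ∀ {n} r {w} → w ∈ words n r → length w ≡ r × All (InRange n) w
∈-words⁻     zero    (here refl) = refl , []
∈-words⁻ {n} (suc r) w∈ with _ , _ , x∈ , w′∈ , refl ← ∈-consEach⁻ (applyUpTo suc n) (words n r) w∈ =
  let |w′| , w′-in-range = ∈-words⁻ r w′∈ in cong suc |w′| , ∈-range⁻ x∈ ∷ w′-in-range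

unique-words : ∀ n r → Unique (words n r)
unique-words n zero    = [] ∷ []
unique-words n (suc r) = consEach⁺ _ _ (unique-range n) (unique-words n r)

∈-fillings⁺ : ∀ {n t} → All (All (InRange n)) t → t ∈ fillings n (map length t)
∈-fillings⁺ []        = here refl
∈-fillings⁺ (r∈ ∷ t∈) = ∈-consEach⁺ _ _ (∈-words⁺ r∈) (∈-fillings⁺ t∈)

∈-fillings⁻ : ∀ {n} sh {t} → t ∈ fillings n sh → map length t ≡ sh × All (All (InRange n)) t
∈-fillings⁻     []       (here refl) = refl , []
∈-fillings⁻ {n} (r ∷ sh) t∈ with _ , _ , r∈ , t′∈ , refl ← ∈-consEach⁻ (words n r) (fillings n sh) t∈ =
  let |r| , r-in-range = ∈-words⁻ r r∈ ; shape , t′-in-range = ∈-fillings⁻ sh t′∈ in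
  cong₂ _∷_ |r| shape , r-in-range ∷ t′-in-range

unique-fillings : ∀ n sh → Unique (fillings n sh)
unique-fillings n []       = [] ∷ []
unique-fillings n (r ∷ sh) = consEach⁺ _ _ (unique-words n r) (unique-fillings n sh)

∈-SYTs⁺ : ∀ {sh t} → map length t ≡ sh → IsTableau (sum sh) t → t ∈ SYTs sh
∈-SYTs⁺ refl τ =
  ∈-filter⁺ (T? ∘ isSYTᵇ _) (∈-fillings⁺ (concat⁻ (IsTableau.entries-in-range τ)))
    (Equivalence.from T-isSYTᵇ τ)

∈-SYTs⁻ : ∀ sh {t} → t ∈ SYTs sh → map length t ≡ sh × IsTableau (sum sh) t
∈-SYTs⁻ sh t∈ with t∈fillings , isSYT ← ∈-filter⁻ (T? ∘ isSYTᵇ _) t∈ =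
  proj₁ (∈-fillings⁻ sh t∈fillings) , Equivalence.to T-isSYTᵇ isSYT

unique-SYTs : ∀ sh → Unique (SYTs sh)
unique-SYTs sh = Unique.filter⁺ (T? ∘ isSYTᵇ _) (unique-fillings (sum sh) sh)

-- The superstandard tableau

consecutive : ℕ → ℕ → List ℕ
consecutive s zero    = []
consecutive s (suc m) = suc s ∷ consecutive (suc s) m

superstandard : ℕ → List ℕ → List (List ℕ)
superstandard s []       = []
superstandard s (r ∷ sh) = consecutive s r ∷ superstandard (s + r) sh

length-consecutive : ∀ s m → length (consecutive s m) ≡ m
length-consecutive s zero    = refl
length-consecutive s (suc m) = cong suc (length-consecutive (suc s) m)

consecutive-+ : ∀ s a b → consecutive s (a + b) ≡ consecutive s a ++ consecutive (s + a) b
consecutive-+ s zero    b = cong (λ s′ → consecutive s′ b) (sym (ℕ.+-identityʳ s))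
consecutive-+ s (suc a) b = cong (suc s ∷_)
  (trans (consecutive-+ (suc s) a b) (cong (λ s′ → consecutive (suc s) a ++ consecutive s′ b) (sym (ℕ.+-suc s a))))

consecutive-bounds : ∀ s m → All (λ x → s < x × x ≤ s + m) (consecutive s m)
consecutive-bounds s zero    = []
consecutive-bounds s (suc m) rewrite ℕ.+-suc s m =
  (ℕ.n<1+n s , s≤s (ℕ.m≤m+n s m)) ∷
  All.map (λ (s<x , x≤) → ℕ.<-trans (ℕ.n<1+n s) s<x , x≤) (consecutive-bounds (suc s) m)

consecutive-increasing : ∀ s m → Linked _<_ (consecutive s m)
consecutive-increasing s zero          = []
consecutive-increasing s (suc zero)    = [-]
consecutive-increasing s (suc (suc m)) = ℕ.n<1+n (suc s) ∷ consecutive-increasing (suc s) (suc m)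

consecutive-above : ∀ {s s′} r {r′} → s < s′ → r′ ≤ r → Above (consecutive s r) (consecutive s′ r′)
consecutive-above r       {zero}   _    _          = []
consecutive-above (suc r) {suc r′} s<s′ (s≤s r′≤r) = s≤s s<s′ ∷ consecutive-above r (s≤s s<s′) r′≤r

applyUpTo≡consecutive : ∀ s m {f : ℕ → ℕ} → (∀ j → f j ≡ suc (s + j)) → applyUpTo f m ≡ consecutive s m
applyUpTo≡consecutive s zero    _  = refl
applyUpTo≡consecutive s (suc m) f≗ = cong₂ _∷_ (trans (f≗ 0) (cong suc (ℕ.+-identityʳ s)))
  (applyUpTo≡consecutive (suc s) m λ j → trans (f≗ (suc j)) (cong suc (ℕ.+-suc s j)))

shape-superstandard : ∀ s sh → map length (superstandard s sh) ≡ sh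
shape-superstandard s []       = refl
shape-superstandard s (r ∷ sh) = cong₂ _∷_ (length-consecutive s r) (shape-superstandard (s + r) sh)

concat-superstandard : ∀ s sh → concat (superstandard s sh) ≡ consecutive s (sum sh)
concat-superstandard s []       = refl
concat-superstandard s (r ∷ sh) =
  trans (cong (consecutive s r ++_) (concat-superstandard (s + r) sh)) (sym (consecutive-+ s r (sum sh)))

superstandard-rows : ∀ s sh → All (Linked _<_) (superstandard s sh)
superstandard-rows s []       = []
superstandard-rows s (r ∷ sh) = consecutive-increasing s r ∷ superstandard-rows (s + r) sh

superstandard-columns : ∀ s sh → IsPartition sh → Linked Above (superstandard s sh)
superstandard-columns s []            _                          = []
superstandard-columns s (r ∷ [])      _                          = [-]
superstandard-columns s (r ∷ r′ ∷ sh) (1≤r ∷ pos , r≥r′ ∷ decr) =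
  consecutive-above r (ℕ.m<m+n s 1≤r) r≥r′ ∷ superstandard-columns (s + r) (r′ ∷ sh) (pos , decr)

superstandard-isTableau : ∀ sh → IsPartition sh → IsTableau (sum sh) (superstandard 0 sh)
superstandard-isTableau sh λ-partition = record
  { rows-increasing    = superstandard-rows 0 sh
  ; columns-increasing = superstandard-columns 0 sh λ-partition
  ; entries-unique     = subst Unique (sym (concat-superstandard 0 sh))
      (AllPairs.map ℕ.<⇒≢ (Linked⇒AllPairs ℕ.<-trans (consecutive-increasing 0 (sum sh))))
  ; entries-in-range   = subst (All (InRange (sum sh))) (sym (concat-superstandard 0 sh)) (consecutive-bounds 0 (sum sh))
  }

SYTs-nonempty : ∀ sh → IsPartition sh → 0 < length (SYTs sh)
SYTs-nonempty sh λ-partition = ∈-length (∈-SYTs⁺ (shape-superstandard 0 sh) (superstandard-isTableau sh λ-partition))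

-- The events along the first column

T-eventᵇ : ∀ {ℓ i t} →
  T (eventᵇ ℓ i t) ⇔ (entry t i 1 < entry t 1 2 × (i < ℓ → entry t 1 2 < entry t (suc i) 1))
T-eventᵇ {ℓ} {i} {t} with suc i ≤ᵇ ℓ in eq
... | true  = mk⇔
  (λ h → let below , above = Equivalence.to T-∧ h in ℕ.<ᵇ⇒< _ _ below , λ _ → ℕ.<ᵇ⇒< _ _ above)
  (λ (below , above) → ∧-intro (ℕ.<⇒<ᵇ below) (ℕ.<⇒<ᵇ (above (ℕ.≤ᵇ⇒≤ _ _ (subst T (sym eq) _)))))
... | false = mk⇔
  (λ h → ℕ.<ᵇ⇒< _ _ h , λ i<ℓ → contradiction (subst T eq (ℕ.≤⇒≤ᵇ i<ℓ)) λ ())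
  (λ (below , _) → ℕ.<⇒<ᵇ below)

module ColumnEvents (ℓ : ℕ) (t : List (List ℕ))
  (column-increasing : ∀ {i} → 1 ≤ i → i < ℓ → entry t i 1 < entry t (suc i) 1)
  (column-avoids : ∀ {i} → 1 ≤ i → i ≤ ℓ → entry t 1 2 ≢ entry t i 1)
  where

  private
    G : ℕ → ℕ
    G i = entry t i 1

    c : ℕ
    c = entry t 1 2

    count : List ℕ → ℕ
    count is = length (filterᵇ (λ i → eventᵇ ℓ i t) is)

    event⇔ : ∀ {i} → T (eventᵇ ℓ i t) ⇔ (G i < c × (i < ℓ → c < G (suc i)))
    event⇔ = T-eventᵇ {t = t}

    count-∷-yes : ∀ {i} is → T (eventᵇ ℓ i t) → count (i ∷ is) ≡ suc (count is)
    count-∷-yes is ev = cong length (filter-accept (T? ∘ (λ i → eventᵇ ℓ i t)) ev)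

    count-∷-no : ∀ {i} is → ¬ T (eventᵇ ℓ i t) → count (i ∷ is) ≡ count is
    count-∷-no is ¬ev = cong length (filter-reject (T? ∘ (λ i → eventᵇ ℓ i t)) ¬ev)

    shrink : ∀ {s d} → suc s + suc d ≡ ℓ → suc (suc s) + d ≡ ℓ
    shrink {s} {d} eq = trans (sym (ℕ.+-suc (suc s) d)) eq

    not-last : ∀ {s d} → suc s + suc d ≡ ℓ → suc s < ℓ
    not-last {s} {d} eq = subst (suc (suc s) ≤_) (shrink eq) (ℕ.m≤m+n (suc (suc s)) d)

  count-≡0 : ∀ s d → suc s + d ≡ ℓ → c < G (suc s) → count (consecutive s (suc d)) ≡ 0
  count-≡0 s zero    _  c<G = count-∷-no [] λ ev → ℕ.<-asym c<G (proj₁ (Equivalence.to event⇔ ev))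
  count-≡0 s (suc d) eq c<G = trans (count-∷-no _ λ ev → ℕ.<-asym c<G (proj₁ (Equivalence.to event⇔ ev)))
    (count-≡0 (suc s) d (shrink eq) (ℕ.<-trans c<G (column-increasing (s≤s z≤n) (not-last eq))))

  count-≡1 : ∀ s d → suc s + d ≡ ℓ → G (suc s) < c → count (consecutive s (suc d)) ≡ 1
  count-≡1 s zero    eq G<c = count-∷-yes [] (Equivalence.from event⇔
    (G<c , λ s+1<ℓ → contradiction s+1<ℓ (ℕ.<-irrefl (trans (sym (ℕ.+-identityʳ (suc s))) eq))))
  count-≡1 s (suc d) eq G<c with ℕ.<-cmp c (G (suc (suc s)))
  ... | tri< c<G′ _ _ = trans (count-∷-yes _ (Equivalence.from event⇔ (G<c , λ _ → c<G′)))
                              (cong suc (count-≡0 (suc s) d (shrink eq) c<G′))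
  ... | tri≈ _ c≡G′ _ = contradiction c≡G′ (column-avoids (s≤s z≤n) (not-last eq))
  ... | tri> _ _ G′<c =
    trans (count-∷-no _ λ ev → ℕ.<-asym G′<c (proj₂ (Equivalence.to event⇔ ev) (not-last eq)))
          (count-≡1 (suc s) d (shrink eq) G′<c)

  exactly-one : 1 ≤ ℓ → G 1 < c → count (applyUpTo suc ℓ) ≡ 1
  exactly-one (s≤s {n = ℓ′} z≤n) G1<c =
    trans (cong count (applyUpTo≡consecutive 0 ℓ λ _ → refl)) (count-≡1 0 ℓ′ refl G1<c)

-- Rows, their leading entries, and the exchange

lead : List ℕ → ℕ
lead []      = 0
lead (x ∷ _) = x

rowAt : ℕ → List (List ℕ) → List ℕ
rowAt _       []       = []
rowAt zero    (r ∷ _)  = r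
rowAt (suc k) (_ ∷ rs) = rowAt k rs

setHead : ℕ → List ℕ → List ℕ
setHead v []       = []
setHead v (_ ∷ xs) = v ∷ xs

setLead : ℕ → ℕ → List (List ℕ) → List (List ℕ)
setLead _       v []       = []
setLead zero    v (r ∷ rs) = setHead v r ∷ rs
setLead (suc k) v (r ∷ rs) = r ∷ setLead k v rs

entry-lead : ∀ t i → entry t (suc i) 1 ≡ lead (rowAt i t)
entry-lead []            i       = refl
entry-lead ([] ∷ t)      zero    = refl
entry-lead ((x ∷ r) ∷ t) zero    = refl
entry-lead (r ∷ t)       (suc i) = entry-lead t i

All-rowAt : ∀ {P : List ℕ → Set} {rs} k → All P rs → k < length rs → P (rowAt k rs)
All-rowAt zero    (p ∷ _)  _        = p
All-rowAt (suc k) (_ ∷ ps) (s≤s k<) = All-rowAt k ps k<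

lead-∈-concat : ∀ k rs → 1 ≤ length (rowAt k rs) → lead (rowAt k rs) ∈ concat rs
lead-∈-concat zero    ((x ∷ _) ∷ _) _  = here refl
lead-∈-concat (suc k) (r ∷ rs)      ne = ∈-++⁺ʳ r (lead-∈-concat k rs ne)

lead-rowAt-setLead : ∀ k {v} rs → 1 ≤ length (rowAt k rs) → lead (rowAt k (setLead k v rs)) ≡ v
lead-rowAt-setLead zero    ((_ ∷ _) ∷ _) _  = refl
lead-rowAt-setLead (suc k) (_ ∷ rs)      ne = lead-rowAt-setLead k rs ne

rowAt-setLead-< : ∀ {j k} v rs → j < k → rowAt j (setLead k v rs) ≡ rowAt j rs
rowAt-setLead-<                 v []       _         = refl
rowAt-setLead-< {zero}  {suc k} v (r ∷ rs) _         = refl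
rowAt-setLead-< {suc j} {suc k} v (r ∷ rs) (s≤s j<k) = rowAt-setLead-< v rs j<k

setLead-setLead : ∀ k v w rs → setLead k v (setLead k w rs) ≡ setLead k v rs
setLead-setLead k       v w []             = refl
setLead-setLead zero    v w ([] ∷ rs)      = refl
setLead-setLead zero    v w ((_ ∷ _) ∷ rs) = refl
setLead-setLead (suc k) v w (r ∷ rs)       = cong (r ∷_) (setLead-setLead k v w rs)

setLead-lead : ∀ k rs → setLead k (lead (rowAt k rs)) rs ≡ rs
setLead-lead k       []             = refl
setLead-lead zero    ([] ∷ rs)      = refl
setLead-lead zero    ((_ ∷ _) ∷ rs) = refl
setLead-lead (suc k) (r ∷ rs)       = cong (r ∷_) (setLead-lead k rs)

shape-setLead : ∀ k v rs → map length (setLead k v rs) ≡ map length rs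
shape-setLead k       v []             = refl
shape-setLead zero    v ([] ∷ rs)      = refl
shape-setLead zero    v ((_ ∷ _) ∷ rs) = refl
shape-setLead (suc k) v (r ∷ rs)       = cong (length r ∷_) (shape-setLead k v rs)

All-setLead : ∀ {P : List ℕ → Set} k v {rs} → All P rs → P (setHead v (rowAt k rs)) → All P (setLead k v rs)
All-setLead k       v []       _ = []
All-setLead zero    v (_ ∷ ps) p = p ∷ ps
All-setLead (suc k) v (p ∷ ps) q = p ∷ All-setLead k v ps q

concat-setLead-↭ : ∀ k v rs → 1 ≤ length (rowAt k rs) →
  v ∷ concat rs ↭ lead (rowAt k rs) ∷ concat (setLead k v rs)
concat-setLead-↭ zero    v ((a ∷ _) ∷ rs) _  = ↭-swap v a ↭-refl
concat-setLead-↭ (suc k) v (r ∷ rs)       ne = begin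
  v ∷ r ++ concat rs                               ↭⟨ ↭-shift v r (concat rs) ⟨
  r ++ v ∷ concat rs                               ↭⟨ ++⁺ˡ r (concat-setLead-↭ k v rs ne) ⟩
  r ++ lead (rowAt k rs) ∷ concat (setLead k v rs) ↭⟨ ↭-shift _ r _ ⟩
  lead (rowAt k rs) ∷ r ++ concat (setLead k v rs) ∎
  where open PermutationReasoning

Above-trans : ∀ {u v w} → Above u v → Above v w → Above u w
Above-trans _         []        = []
Above-trans (x<y ∷ a) (y<z ∷ b) = ℕ.<-trans x<y y<z ∷ Above-trans a b

Above-lead : ∀ {u w} → Above u w → 1 ≤ length w → lead u < lead w
Above-lead (x<y ∷ _) _ = x<y

Above-rowAt : ∀ {u rs} k → Linked Above (u ∷ rs) → k < length rs → Above u (rowAt k rs)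
Above-rowAt {rs = _ ∷ _} zero    (a ∷ _) _        = a
Above-rowAt {rs = _ ∷ _} (suc k) (a ∷ l) (s≤s k<) = Above-trans a (Above-rowAt k l k<)

Above-rowAt-suc : ∀ {rs} j → Linked Above rs → suc j < length rs → Above (rowAt j rs) (rowAt (suc j) rs)
Above-rowAt-suc {_ ∷ _} zero    l (s≤s j<) = Above-rowAt 0 l j<
Above-rowAt-suc {_ ∷ _} (suc j) l (s≤s j<) = Above-rowAt-suc j (Linked.tail l) j<

Above-setHead-below : ∀ {u w v} → Above u w → lead w ≤ v → Above u (setHead v w)
Above-setHead-below []        _   = []
Above-setHead-below (x<y ∷ a) y≤v = ℕ.<-≤-trans x<y y≤v ∷ a

Above-setHead-above : ∀ {w w′ v} → Above w w′ → (1 ≤ length w′ → v < lead w′) → Above (setHead v w) w′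
Above-setHead-above []      _  = []
Above-setHead-above (_ ∷ a) v< = v< (s≤s z≤n) ∷ a

Above-lower-second : ∀ {x c a r w} → Above (x ∷ c ∷ r) w → a ≤ c → Above (x ∷ a ∷ r) w
Above-lower-second []                _   = []
Above-lower-second (x< ∷ [])         _   = x< ∷ []
Above-lower-second (x< ∷ c< ∷ above) a≤c = x< ∷ ℕ.≤-<-trans a≤c c< ∷ above

Linked-replaceHead : ∀ {A : Set} {R : A → A → Set} {x y xs} →
  (∀ {z} → R x z → R y z) → Linked R (x ∷ xs) → Linked R (y ∷ xs)
Linked-replaceHead f [-]     = [-]
Linked-replaceHead f (r ∷ l) = f r ∷ l

Linked-setHead : ∀ {x c r w} → Linked _<_ w → Above (x ∷ c ∷ r) w → Linked _<_ (setHead c w)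
Linked-setHead []      _             = []
Linked-setHead [-]     _             = [-]
Linked-setHead (_ ∷ l) (_ ∷ c<b ∷ _) = c<b ∷ l

Linked-setLead : ∀ k {v} rs → Linked Above rs → lead (rowAt k rs) ≤ v →
  (suc k < length rs → v < lead (rowAt (suc k) rs)) → Linked Above (setLead k v rs)
Linked-setLead k             []            _       _   _  = []
Linked-setLead zero          (_ ∷ [])      _       _   _  = [-]
Linked-setLead zero          (_ ∷ _ ∷ _)   (a ∷ l) _   v< =
  Above-setHead-above a (λ _ → v< (s≤s (s≤s z≤n))) ∷ l
Linked-setLead (suc k)       (_ ∷ [])      _       _   _  = [-]
Linked-setLead (suc zero)    (_ ∷ r′ ∷ rs) (a ∷ l) a≤v v< =
  Above-setHead-below a a≤v ∷ Linked-setLead zero (r′ ∷ rs) l a≤v (v< ∘ s≤s)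
Linked-setLead (suc (suc k)) (_ ∷ r′ ∷ rs) (a ∷ l) a≤v v< =
  a ∷ Linked-setLead (suc k) (r′ ∷ rs) l a≤v (v< ∘ s≤s)

-- exchange k swaps A(1,2) with A(k+2,1), the leading entry of row k of the rows below the first.
exchange : ℕ → List (List ℕ) → List (List ℕ)
exchange k ((x ∷ c ∷ r) ∷ rows) = (x ∷ lead (rowAt k rows) ∷ r) ∷ setLead k c rows
exchange k t                    = t

lead-before-exchanged : ∀ k {x c r rows} → Linked Above ((x ∷ c ∷ r) ∷ rows) →
  k < length rows → 1 ≤ length (rowAt k rows) →
  lead (rowAt k (exchange k ((x ∷ c ∷ r) ∷ rows))) < lead (rowAt k rows)
lead-before-exchanged zero                          cols k< ne = Above-lead (Above-rowAt 0 cols k<) ne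
lead-before-exchanged (suc j) {c = c} {rows = rows} cols k< ne rewrite rowAt-setLead-< {j} c rows (ℕ.n<1+n j) =
  Above-lead (Above-rowAt-suc j (Linked.tail cols) k<) ne

module _ {x c : ℕ} {r : List ℕ} {rows : List (List ℕ)}
         (k : ℕ) (k< : k < length rows) (nonempty : All ((1 ≤_) ∘ length) rows) where

  private
    t : List (List ℕ)
    t = (x ∷ c ∷ r) ∷ rows

    a : ℕ
    a = lead (rowAt k rows)

    row-nonempty : 1 ≤ length (rowAt k rows)
    row-nonempty = All-rowAt k nonempty k<

  exchange-involutive : exchange k (exchange k t) ≡ t
  exchange-involutive = cong₂ (λ c′ rows′ → (x ∷ c′ ∷ r) ∷ rows′)
    (lead-rowAt-setLead k rows row-nonempty)
    (trans (setLead-setLead k a c rows) (setLead-lead k rows))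

  exchange-concat-↭ : concat t ↭ concat (exchange k t)
  exchange-concat-↭ = prep x (concat-setLead-↭ (suc k) c (r ∷ rows) row-nonempty)

  exchange-isTableau : ∀ {n} → IsTableau n t → a < c → (suc k < length rows → c < lead (rowAt (suc k) rows)) →
    IsTableau n (exchange k t)
  exchange-isTableau τ a<c c<next = record
    { rows-increasing    = first-row ∷ All-setLead k c rows-below (Linked-setHead (All-rowAt k rows-below k<) above-k)
    ; columns-increasing = Linked-setLead (suc k) ((x ∷ a ∷ r) ∷ rows)
        (Linked-replaceHead (λ above → Above-lower-second above (ℕ.<⇒≤ a<c)) columns-increasing)
        (ℕ.<⇒≤ a<c) (c<next ∘ ℕ.≤-pred)
    ; entries-unique     = Unique-resp-↭ (↭⇒↭ₛ exchange-concat-↭) entries-unique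
    ; entries-in-range   = All-resp-↭ exchange-concat-↭ entries-in-range
    }
    where
    open IsTableau τ
    rows-below : All (Linked _<_) rows
    rows-below = All.tail rows-increasing
    above-k : Above (x ∷ c ∷ r) (rowAt k rows)
    above-k = Above-rowAt k columns-increasing k<
    first-row : Linked _<_ (x ∷ a ∷ r)
    first-row with x<c ∷ rest ← All.head rows-increasing =
      Above-lead above-k row-nonempty ∷ Linked-replaceHead (ℕ.<-trans a<c) rest

  exchange-event : ∀ {n} → IsTableau n t → T (eventᵇ (suc (length rows)) (suc (suc k)) t) →
    IsTableau n (exchange k t) × T (eventᵇ (suc (length rows)) (suc k) (exchange k t))
  exchange-event τ ev = exchange-isTableau τ a<c c<next , Equivalence.from event-after⇔ (before<a , λ _ → a<after)
    where
    event-before⇔ : T (eventᵇ (suc (length rows)) (suc (suc k)) t) ⇔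
          (entry t (suc (suc k)) 1 < c × (suc (suc k) < suc (length rows) → c < entry t (suc (suc (suc k))) 1))
    event-before⇔ = T-eventᵇ
    event-after⇔ : T (eventᵇ (suc (length rows)) (suc k) (exchange k t)) ⇔
      (entry (exchange k t) (suc k) 1 < a × (suc k < suc (length rows) → a < entry (exchange k t) (suc (suc k)) 1))
    event-after⇔ = T-eventᵇ
    a<c : a < c
    a<c = subst (_< c) (entry-lead t (suc k)) (proj₁ (Equivalence.to event-before⇔ ev))
    c<next : suc k < length rows → c < lead (rowAt (suc k) rows)
    c<next k+1< = subst (c <_) (entry-lead t (suc (suc k))) (proj₂ (Equivalence.to event-before⇔ ev) (s≤s k+1<))
    before<a : entry (exchange k t) (suc k) 1 < a
    before<a = subst (_< a) (sym (entry-lead (exchange k t) k))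
      (lead-before-exchanged k (IsTableau.columns-increasing τ) k< row-nonempty)
    a<after : a < entry (exchange k t) (suc (suc k)) 1
    a<after = subst (a <_) (sym (trans (entry-lead (exchange k t) (suc k)) (lead-rowAt-setLead k rows row-nonempty))) a<c

exactly-one-event : ∀ {n x c r rows} → IsTableau n ((x ∷ c ∷ r) ∷ rows) → All ((1 ≤_) ∘ length) rows →
  length (filterᵇ (λ i → eventᵇ (suc (length rows)) i ((x ∷ c ∷ r) ∷ rows)) (applyUpTo suc (suc (length rows)))) ≡ 1
exactly-one-event {x = x} {c} {r} {rows} τ nonempty =
  ColumnEvents.exactly-one (suc (length rows)) t column-increasing column-avoids (s≤s z≤n) x<c
  where
  open IsTableau τ
  t : List (List ℕ)
  t = (x ∷ c ∷ r) ∷ rows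
  x<c : x < c
  x<c = Linked.head (All.head rows-increasing)
  column-increasing : ∀ {i} → 1 ≤ i → i < suc (length rows) → entry t i 1 < entry t (suc i) 1
  column-increasing {suc j} _ j+1< rewrite entry-lead t j | entry-lead t (suc j) =
    Above-lead (Above-rowAt-suc j columns-increasing j+1<) (All-rowAt j nonempty (ℕ.≤-pred j+1<))
  column-avoids : ∀ {i} → 1 ≤ i → i ≤ suc (length rows) → c ≢ entry t i 1
  column-avoids {suc zero}    _ _        c≡x = ℕ.<⇒≢ x<c (sym c≡x)
  column-avoids {suc (suc j)} _ (s≤s j<) c≡ with _ ∷ c∉ ∷ _ ← entries-unique =
    All.lookup c∉ (∈-++⁺ʳ r (lead-∈-concat j rows (All-rowAt j nonempty j<))) (trans c≡ (entry-lead t (suc j)))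

data Cell₁₂View (rest : List ℕ) : List (List ℕ) → Set where
  view : ∀ x c r rows → map length rows ≡ rest → Cell₁₂View rest ((x ∷ c ∷ r) ∷ rows)

cell₁₂-view : ∀ {l₁ rest t} → 2 ≤ l₁ → map length t ≡ l₁ ∷ rest → Cell₁₂View rest t
cell₁₂-view {t = (x ∷ c ∷ r) ∷ rows} _        refl = view x c r rows refl
cell₁₂-view {t = [] ∷ _}             ()       refl
cell₁₂-view {t = (_ ∷ []) ∷ _}       (s≤s ()) refl

eventCount : List ℕ → ℕ → ℕ
eventCount sh i = length (filterᵇ (eventᵇ (length sh) i) (SYTs sh))

module _ {l₁ : ℕ} {rest : List ℕ} (λ-partition : IsPartition (l₁ ∷ rest)) (2≤l₁ : 2 ≤ l₁) where

  private
    ℓ : ℕ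
    ℓ = length (l₁ ∷ rest)

    rows-nonempty : ∀ {rows : List (List ℕ)} → map length rows ≡ rest → All ((1 ≤_) ∘ length) rows
    rows-nonempty eq = map⁻ (subst (All (1 ≤_)) (sym eq) (All.tail (proj₁ λ-partition)))

    rows-length : ∀ {rows : List (List ℕ)} → map length rows ≡ rest → length rows ≡ length rest
    rows-length {rows} eq = trans (sym (length-map length rows)) (cong length eq)

  SYT-exactly-one-event : ∀ {t} → t ∈ SYTs (l₁ ∷ rest) →
    length (filterᵇ (λ i → eventᵇ ℓ i t) (applyUpTo suc ℓ)) ≡ 1
  SYT-exactly-one-event t∈ with shape , τ ← ∈-SYTs⁻ (l₁ ∷ rest) t∈ with cell₁₂-view 2≤l₁ shape
  ... | view x c r rows eq =
    subst (λ m → length (filterᵇ (λ i → eventᵇ (suc m) i ((x ∷ c ∷ r) ∷ rows)) (applyUpTo suc (suc m))) ≡ 1)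
      (rows-length eq) (exactly-one-event τ (rows-nonempty eq))

  SYT-exchange : ∀ {k t} → k < length rest → t ∈ SYTs (l₁ ∷ rest) → T (eventᵇ ℓ (suc (suc k)) t) →
    exchange k t ∈ SYTs (l₁ ∷ rest) × T (eventᵇ ℓ (suc k) (exchange k t)) × exchange k (exchange k t) ≡ t
  SYT-exchange {k} k< t∈ ev with shape , τ ← ∈-SYTs⁻ (l₁ ∷ rest) t∈ with cell₁₂-view 2≤l₁ shape
  ... | view x c r rows eq =
    ∈-SYTs⁺ (trans (cong (suc (suc (length r)) ∷_) (shape-setLead k c rows)) shape) (proj₁ exchanged) ,
    subst (λ m → T (eventᵇ m (suc k) (exchange k t))) (sym ℓ≡) (proj₂ exchanged) ,
    exchange-involutive k k<rows nonempty
    where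
    t : List (List ℕ)
    t = (x ∷ c ∷ r) ∷ rows
    k<rows : k < length rows
    k<rows = subst (k <_) (sym (rows-length eq)) k<
    nonempty : All ((1 ≤_) ∘ length) rows
    nonempty = rows-nonempty eq
    ℓ≡ : ℓ ≡ suc (length rows)
    ℓ≡ = cong suc (sym (rows-length eq))
    exchanged : IsTableau (sum (l₁ ∷ rest)) (exchange k t) × T (eventᵇ (suc (length rows)) (suc k) (exchange k t))
    exchanged = exchange-event k k<rows nonempty τ (subst (λ m → T (eventᵇ m (suc (suc k)) t)) ℓ≡ ev)

  eventCount-decreasing : ∀ k → k < length rest →
    eventCount (l₁ ∷ rest) (suc (suc k)) ≤ eventCount (l₁ ∷ rest) (suc k)
  eventCount-decreasing k k< = begin
    length E₂                    ≤⟨ Unique-⊆⇒length-≤ E₂-unique E₂⊆ ⟩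
    length (map (exchange k) E₁) ≡⟨ length-map (exchange k) E₁ ⟩
    length E₁                    ∎
    where
    open ℕ.≤-Reasoning
    E₁ E₂ : List (List (List ℕ))
    E₁ = filterᵇ (eventᵇ ℓ (suc k)) (SYTs (l₁ ∷ rest))
    E₂ = filterᵇ (eventᵇ ℓ (suc (suc k))) (SYTs (l₁ ∷ rest))
    E₂-unique : Unique E₂
    E₂-unique = Unique.filter⁺ (T? ∘ eventᵇ ℓ (suc (suc k))) (unique-SYTs (l₁ ∷ rest))
    E₂⊆ : E₂ ⊆ map (exchange k) E₁
    E₂⊆ t∈E₂ with t∈ , ev ← ∈-filter⁻ (T? ∘ eventᵇ ℓ (suc (suc k))) t∈E₂
             with t′∈ , ev′ , involution ← SYT-exchange k< t∈ ev =
      subst (_∈ map (exchange k) E₁) involution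
        (∈-map⁺ (exchange k) (∈-filter⁺ (T? ∘ eventᵇ ℓ (suc k)) t′∈ ev′))

lemma3p2 : (l₁ : ℕ) (rest : List ℕ) → IsPartition (l₁ ∷ rest) → 2 ≤ l₁ →
    ((i : ℕ) → 1 ≤ i → i < length (l₁ ∷ rest) → q (l₁ ∷ rest) (suc i) ≤ℚ q (l₁ ∷ rest) i)
    × (qSum (l₁ ∷ rest) ≡ 1ℚ)
lemma3p2 l₁ rest λ-partition 2≤l₁ = q-decreasing , q-sum
  where
  sh : List ℕ
  sh = l₁ ∷ rest
  N : ℕ
  N = length (SYTs sh)
  q-decreasing : (i : ℕ) → 1 ≤ i → i < length sh → q sh (suc i) ≤ℚ q sh i
  q-decreasing (suc k) _ (s≤s k<) = prob-mono N (eventCount-decreasing λ-partition 2≤l₁ k k<)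
  q-sum : qSum sh ≡ 1ℚ
  q-sum = begin
    qSum sh                                                        ≡⟨ sum-prob (eventCount sh) N (applyUpTo suc (length sh)) ⟩
    prob (sum (map (eventCount sh) (applyUpTo suc (length sh)))) N ≡⟨ cong (λ m → prob m N) all-events ⟩
    prob N N                                                       ≡⟨ prob-self (SYTs-nonempty sh λ-partition) ⟩
    1ℚ                                                             ∎
    where
    open ≡-Reasoning
    all-events : sum (map (eventCount sh) (applyUpTo suc (length sh))) ≡ N
    all-events = sum-length-filterᵇ≡length (eventᵇ (length sh)) (applyUpTo suc (length sh)) (SYTs sh)
      (SYT-exactly-one-event λ-partition 2≤l₁)
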